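{- If $G$ is a tree with at least one edge, then $\mathrm{lec}(G)=\mathrm{rw}(G)$, where $\mathrm{rw}(G)=\max\{\deg_G(u)+\deg_G(v)-1 : uv\in E(G)\}$.
   Context: Given an edge-colouring $\varphi:E(G)\to[1,k]$, a path is loose if it consists of exactly one edge, or of exactly two edges of different colours, or has at least three edges coloured with at least three distinct colours. $\mathrm{lec}(G)$ is the least $k$ for which there is an edge-colouring with $k$ colours such that every two distinct vertices are joined by a loose path. -}

module Defs where

open import Data.Bool using (Bool; true; false; T; if_then_else_)
open import Data.Nat using (ℕ; zero; suc; _+_; _∸_; _⊔_; _≤_)
open import Data.Fin using (Fin)
open import Data.List using (List; []; _∷_; length; zipWith; drop; head; last; allFin; map; foldr; concatMap)
open import Data.List.Membership.Propositional using (_∈_)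
open import Data.List.Relation.Unary.Linked using (Linked)
open import Data.List.Relation.Unary.Unique.Propositional using (Unique)
open import Data.Maybe using (Maybe; just)
open import Data.Product using (Σ; _×_; ∃)
open import Data.Sum using (_⊎_)
open import Relation.Binary.PropositionalEquality using (_≡_; _≢_)

record Graph (n : ℕ) : Set where
  field
    adj   : Fin n → Fin n → Bool
    sym   : ∀ u v → adj u v ≡ adj v u
    irrefl : ∀ u → adj u u ≡ false

module _ {n : ℕ} (G : Graph n) where
  open Graph G

  Edge : Fin n → Fin n → Set
  Edge u v = T (adj u v)

  deg : Fin n → ℕ
  deg u = foldr _+_ 0 (map (λ v → if adj u v then 1 else 0) (allFin n))

  -- rw(G) = max { deg u + deg v - 1 : uv ∈ E(G) }  (0 if G has no edges)
  rw : ℕ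
  rw = foldr _⊔_ 0
         (concatMap (λ u → map (λ v → if adj u v then deg u + deg v ∸ 1 else 0) (allFin n))
                    (allFin n))

  IsPath : List (Fin n) → Set
  IsPath vs = Unique vs × Linked Edge vs

  PathBetween : Fin n → Fin n → List (Fin n) → Set
  PathBetween u v vs = IsPath vs × head vs ≡ just u × last vs ≡ just v

  Connected : Set
  Connected = ∀ u v → ∃ λ vs → PathBetween u v vs

  HasCycle : Set
  HasCycle = Σ (List (Fin n)) λ vs → IsPath vs × 3 ≤ length vs ×
               Σ (Fin n) λ a → Σ (Fin n) λ b → head vs ≡ just a × last vs ≡ just b × Edge b a

  IsTree : Set
  IsTree = Connected × (HasCycle → Data.Empty.⊥)
    where import Data.Empty

  HasEdge : Set
  HasEdge = Σ (Fin n) λ u → Σ (Fin n) λ v → Edge u v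

  -- an edge-colouring with colours Fin k (i.e. [1,k]); it is a function of
  -- the (unordered) edge, hence symmetric on edges
  record EdgeColouring (k : ℕ) : Set where
    field
      col    : Fin n → Fin n → Fin k
      col-sym : ∀ u v → Edge u v → col u v ≡ col v u

  pathColours : ∀ {k} → EdgeColouring k → List (Fin n) → List (Fin k)
  pathColours φ vs = zipWith (EdgeColouring.col φ) vs (drop 1 vs)

  LooseColours : ∀ {k} → List (Fin k) → Set
  LooseColours cs =
      length cs ≡ 1
    ⊎ (Σ _ λ a → Σ _ λ b → cs ≡ a ∷ b ∷ [] × a ≢ b)
    ⊎ (3 ≤ length cs × Σ _ λ a → Σ _ λ b → Σ _ λ c →
         a ∈ cs × b ∈ cs × c ∈ cs × a ≢ b × a ≢ c × b ≢ c)

  IsLoosePath : ∀ {k} → EdgeColouring k → List (Fin n) → Set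
  IsLoosePath φ vs = LooseColours (pathColours φ vs)

  IsLooseConnecting : ∀ {k} → EdgeColouring k → Set
  IsLooseConnecting φ = ∀ u v → u ≢ v → ∃ λ vs → PathBetween u v vs × IsLoosePath φ vs

  LooseColourable : ℕ → Set
  LooseColourable k = Σ (EdgeColouring k) IsLooseConnecting

  LecIs : ℕ → Set
  LecIs k = LooseColourable k × (∀ k' → LooseColourable k' → k ≤ k')

-- Lower bound: a tree has exactly one path between any two vertices, so under a loose colouring
-- every path with two or three edges is rainbow (a path with three edges needs three colours).
-- Hence for an edge uv the deg u + deg v - 1 edges meeting u or v get pairwise distinct colours.
-- Upper bound: root the tree and give each edge the colour of its lower end. The edges from p down
-- to its children get distinct colours avoiding every colour at the parent of p; this is possible
-- because at most deg (parent p) colours meet the parent, p has at most deg p - 1 children, and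
-- deg p + deg (parent p) - 1 <= rw. Then any three consecutive edges are rainbow, so every path
-- between distinct vertices is loose.
module Submission where

open import Defs
open import Data.Bool using (Bool; true; false; T; if_then_else_)
open import Data.Empty using (⊥; ⊥-elim)
open import Data.Fin using (Fin; zero; suc; toℕ; fromℕ<) renaming (_<_ to _<ᶠ_)
import Data.Fin.Properties as Fin
open import Data.Fin.Properties using (_≟_; injective⇒≤; toℕ-injective; toℕ<n)
open import Data.List using (List; []; _∷_; _++_; length; take; head; last; allFin; map; foldr; filter)
open import Data.List.Properties using (length-++; length-map; length-take; length-tabulate; filter-all)
open import Data.List.Membership.Propositional using (_∈_; _∉_)
open import Data.List.Membership.Propositional.Properties
  using (∈-allFin; ∈-filter⁺; ∈-filter⁻; ∈-++⁺ˡ; ∈-++⁺ʳ; ∈-length; ∈-∃++; ∈-map⁻)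
open import Data.List.Membership.Setoid.Properties using (index-injective)
open import Data.List.Relation.Unary.All using (All; []; _∷_)
import Data.List.Relation.Unary.All as All
open import Data.List.Relation.Unary.All.Properties using (All¬⇒¬Any; ¬Any⇒All¬)
import Data.List.Relation.Unary.All.Properties as All
open import Data.List.Relation.Unary.AllPairs using ([]; _∷_)
open import Data.List.Relation.Unary.Any using (Any; here; there)
import Data.List.Relation.Unary.Any.Properties as Any
open import Data.List.Relation.Unary.Linked using (Linked; []; [-]; _∷_)
open import Data.List.Relation.Unary.Unique.Propositional using (Unique)
open import Data.List.Relation.Unary.Unique.Propositional.Properties using (allFin⁺; filter⁺)
import Data.List.Relation.Unary.Unique.Propositional.Properties as Unique
open import Data.Maybe using (just; fromMaybe)
open import Data.Maybe.Properties using (just-injective)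
open import Data.Nat using (ℕ; zero; suc; _+_; _∸_; _⊔_; _≤_; _<_; z≤n; s≤s)
open import Data.Nat.Properties hiding (_≟_)
open import Data.Product using (Σ; _×_; ∃; _,_; proj₁; proj₂)
open import Data.Sum using (_⊎_; inj₁; inj₂)
open import Function using (_∘_; id)
open import Relation.Binary.Definitions using (DecidableEquality; tri<; tri≈; tri>)
open import Relation.Binary.PropositionalEquality
  using (_≡_; _≢_; refl; sym; trans; cong; cong₂; subst; subst₂; setoid; ≢-sym)
open import Relation.Nullary using (¬_; Dec; yes; no; ¬?)
open import Relation.Nullary.Decidable using (T?; isYes; toWitness; fromWitness; _×-dec_)

module _ {A : Set} where

  countᵇ : (A → Bool) → List A → ℕ
  countᵇ f xs = foldr _+_ 0 (map (λ x → if f x then 1 else 0) xs)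

  countᵇ-mono : ∀ {f g : A → Bool} xs → (∀ {x} → x ∈ xs → T (f x) → T (g x)) →
                countᵇ f xs ≤ countᵇ g xs
  countᵇ-mono [] _ = z≤n
  countᵇ-mono {f} {g} (x ∷ xs) f⇒g with f x | g x | f⇒g (here refl)
  ... | true  | true  | _      = s≤s (countᵇ-mono xs (f⇒g ∘ there))
  ... | true  | false | f⇒g[x] = ⊥-elim (f⇒g[x] _)
  ... | false | true  | _      = m≤n⇒m≤1+n (countᵇ-mono xs (f⇒g ∘ there))
  ... | false | false | _      = countᵇ-mono xs (f⇒g ∘ there)

  countᵇ-mono-< : ∀ {f g : A → Bool} {a} xs → (∀ {x} → x ∈ xs → T (f x) → T (g x)) →
                  a ∈ xs → T (g a) → ¬ T (f a) → countᵇ f xs < countᵇ g xs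
  countᵇ-mono-< {f} {g} (x ∷ xs) f⇒g (here refl) ga ¬fa with f x | g x
  ... | true  | _     = ⊥-elim (¬fa _)
  ... | false | true  = s≤s (countᵇ-mono xs (f⇒g ∘ there))
  ... | false | false = ⊥-elim ga
  countᵇ-mono-< {f} {g} (x ∷ xs) f⇒g (there a∈xs) ga ¬fa with f x | g x | f⇒g (here refl)
  ... | true  | true  | _      = s≤s (countᵇ-mono-< xs (f⇒g ∘ there) a∈xs ga ¬fa)
  ... | true  | false | f⇒g[x] = ⊥-elim (f⇒g[x] _)
  ... | false | true  | _      = m<n⇒m<1+n (countᵇ-mono-< xs (f⇒g ∘ there) a∈xs ga ¬fa)
  ... | false | false | _      = countᵇ-mono-< xs (f⇒g ∘ there) a∈xs ga ¬fa

  length-filter-T? : ∀ f xs → length (filter (λ x → T? (f x)) xs) ≡ countᵇ f xs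
  length-filter-T? f [] = refl
  length-filter-T? f (x ∷ xs) with f x
  ... | true  = cong suc (length-filter-T? f xs)
  ... | false = length-filter-T? f xs

  length-take≤ : ∀ m (xs : List A) → length (take m xs) ≤ m
  length-take≤ m xs = subst (_≤ m) (sym (length-take m xs)) (m⊓n≤m m _)

  last-∈ : ∀ (x : A) xs {y} → last (x ∷ xs) ≡ just y → y ∈ x ∷ xs
  last-∈ x [] refl = here refl
  last-∈ x (x′ ∷ xs) eq = there (last-∈ x′ xs eq)

  last-snoc : ∀ (x : A) xs y → last (x ∷ xs ++ y ∷ []) ≡ just y
  last-snoc x [] y = refl
  last-snoc x (x′ ∷ xs) y = last-snoc x′ xs y

  Unique-truncate : ∀ xs {y : A} {ys} → Unique (xs ++ y ∷ ys) → Unique (xs ++ y ∷ [])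
  Unique-truncate [] _ = [] ∷ []
  Unique-truncate (x ∷ xs) (x∉ ∷ u) =
    All.++⁺ (All.++⁻ˡ xs x∉) (All.head (All.++⁻ʳ xs x∉) ∷ []) ∷ Unique-truncate xs u

  Linked-truncate : ∀ {R : A → A → Set} xs {y ys} → Linked R (xs ++ y ∷ ys) → Linked R (xs ++ y ∷ [])
  Linked-truncate [] _ = [-]
  Linked-truncate (x ∷ []) (r ∷ _) = r ∷ [-]
  Linked-truncate (x ∷ x′ ∷ xs) (r ∷ l) = r ∷ Linked-truncate (x′ ∷ xs) l

  no-three-distinct-in-pair : ∀ {x y a b c : A} → a ∈ x ∷ y ∷ [] → b ∈ x ∷ y ∷ [] → c ∈ x ∷ y ∷ [] →
                              a ≢ b → a ≢ c → b ≢ c → ⊥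
  no-three-distinct-in-pair (here refl)         (here refl)         _                   a≢b _   _   = a≢b refl
  no-three-distinct-in-pair (here refl)         (there (here refl)) (here refl)         _   a≢c _   = a≢c refl
  no-three-distinct-in-pair (here refl)         (there (here refl)) (there (here refl)) _   _   b≢c = b≢c refl
  no-three-distinct-in-pair (there (here refl)) (here refl)         (here refl)         _   _   b≢c = b≢c refl
  no-three-distinct-in-pair (there (here refl)) (here refl)         (there (here refl)) _   a≢c _   = a≢c refl
  no-three-distinct-in-pair (there (here refl)) (there (here refl)) _                   a≢b _   _   = a≢b refl

  Unique-map⁺-∈ : ∀ {B : Set} {f : A → B} {xs} → (∀ {x y} → x ∈ xs → y ∈ xs → x ≢ y → f x ≢ f y) →
                  Unique xs → Unique (map f xs)
  Unique-map⁺-∈ {xs = []} _ [] = []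
  Unique-map⁺-∈ {xs = x ∷ xs} f-inj (x∉ ∷ u) =
    All.map⁺ (All.tabulate (λ y∈ → f-inj (here refl) (there y∈) (All.lookup x∉ y∈))) ∷
    Unique-map⁺-∈ (λ x∈ y∈ → f-inj (there x∈) (there y∈)) u

module _ {A : Set} (_≟ᴬ_ : DecidableEquality A) where

  length≤1+length-filter-≢ : ∀ a {xs} → Unique xs → length xs ≤ suc (length (filter (λ x → ¬? (x ≟ᴬ a)) xs))
  length≤1+length-filter-≢ a {[]} _ = z≤n
  length≤1+length-filter-≢ a {x ∷ xs} (x∉xs ∷ u) with x ≟ᴬ a
  ... | yes refl =
    s≤s (≤-reflexive (sym (cong length (filter-all (λ y → ¬? (y ≟ᴬ x)) (All.map ≢-sym x∉xs)))))
  ... | no _     = s≤s (length≤1+length-filter-≢ a u)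

module _ {A : Set} (default : A) where

  nth : List A → ℕ → A
  nth [] _ = default
  nth (x ∷ xs) zero = x
  nth (x ∷ xs) (suc i) = nth xs i

  ∈-nth : ∀ xs {i} → i < length xs → nth xs i ∈ xs
  ∈-nth (x ∷ xs) {zero} _ = here refl
  ∈-nth (x ∷ xs) {suc i} (s≤s i<) = there (∈-nth xs i<)

  nth∈take : ∀ xs {m i} → i < m → i < length xs → nth xs i ∈ take m xs
  nth∈take (x ∷ xs) {suc m} {zero} _ _ = here refl
  nth∈take (x ∷ xs) {suc m} {suc i} (s≤s i<m) (s≤s i<) = there (nth∈take xs i<m i<)

  nth-injective : ∀ {xs i j} → Unique xs → i < length xs → j < length xs → nth xs i ≡ nth xs j → i ≡ j
  nth-injective {x ∷ xs} {zero} {zero} _ _ _ _ = refl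
  nth-injective {x ∷ xs} {zero} {suc j} (x∉xs ∷ _) _ (s≤s j<) x≡ =
    ⊥-elim (All¬⇒¬Any x∉xs (subst (_∈ xs) (sym x≡) (∈-nth xs j<)))
  nth-injective {x ∷ xs} {suc i} {zero} (x∉xs ∷ _) (s≤s i<) _ ≡x =
    ⊥-elim (All¬⇒¬Any x∉xs (subst (_∈ xs) ≡x (∈-nth xs i<)))
  nth-injective {x ∷ xs} {suc i} {suc j} (_ ∷ u) (s≤s i<) (s≤s j<) eq = cong suc (nth-injective u i< j< eq)

module _ {k : ℕ} where
  open import Data.List.Membership.DecPropositional (_≟_ {k}) using (_∈?_)

  Unique⇒length≤ : {cs : List (Fin k)} → Unique cs → length cs ≤ k
  Unique⇒length≤ {[]} _ = z≤n
  Unique⇒length≤ {c ∷ cs} u = injective⇒≤ {f = λ i → nth c (c ∷ cs) (toℕ i)}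
    (λ {i} {j} eq → toℕ-injective (nth-injective c u (toℕ<n i) (toℕ<n j) eq))

  ∀∈⇒length≥ : (cs : List (Fin k)) → (∀ c → c ∈ cs) → k ≤ length cs
  ∀∈⇒length≥ cs ∈cs = injective⇒≤ (λ {c} {d} → index-injective (setoid (Fin k)) (∈cs c) (∈cs d))

  free : List (Fin k) → List (Fin k)
  free cs = filter (λ c → ¬? (c ∈? cs)) (allFin k)

  free-unique : ∀ cs → Unique (free cs)
  free-unique cs = filter⁺ (λ c → ¬? (c ∈? cs)) (allFin⁺ k)

  ∈-free⇒∉ : ∀ cs {c} → c ∈ free cs → c ∉ cs
  ∈-free⇒∉ cs c∈ = proj₂ (∈-filter⁻ (λ c → ¬? (c ∈? cs)) {xs = allFin k} c∈)

  length-free : ∀ cs → k ∸ length cs ≤ length (free cs)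
  length-free cs = m≤n+o⇒m∸n≤o k (length cs) (begin
    k                             ≤⟨ ∀∈⇒length≥ (free cs ++ cs) ∈free++cs ⟩
    length (free cs ++ cs)        ≡⟨ length-++ (free cs) ⟩
    length (free cs) + length cs  ≡⟨ +-comm (length (free cs)) (length cs) ⟩
    length cs + length (free cs)  ∎)
    where
    open ≤-Reasoning
    ∈free++cs : ∀ c → c ∈ free cs ++ cs
    ∈free++cs c with c ∈? cs
    ... | yes c∈cs = ∈-++⁺ʳ (free cs) c∈cs
    ... | no c∉cs  = ∈-++⁺ˡ (∈-filter⁺ (λ c → ¬? (c ∈? cs)) (∈-allFin c) c∉cs)

module _ {n : ℕ} {P : Fin n → Set} (P? : ∀ x → Dec (P x)) where

  size : ℕ
  size = countᵇ (λ x → isYes (P? x)) (allFin n)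

  rank : Fin n → ℕ
  rank x = countᵇ (λ y → isYes (P? y ×-dec y Fin.<? x)) (allFin n)

  rank<size : ∀ {x} → P x → rank x < size
  rank<size {x} Px = countᵇ-mono-< (allFin n) (λ _ t → fromWitness (proj₁ (toWitness t))) (∈-allFin x)
    (fromWitness Px) (λ t → Fin.<-irrefl refl (proj₂ (toWitness t)))

  rank-mono-< : ∀ {x y} → P x → x <ᶠ y → rank x < rank y
  rank-mono-< {x} {y} Px x<y = countᵇ-mono-< (allFin n)
    (λ {z} _ t → let (Pz , z<x) = toWitness {a? = P? z ×-dec z Fin.<? x} t
                 in fromWitness (Pz , Fin.<-trans z<x x<y))
    (∈-allFin x) (fromWitness (Px , x<y)) (λ t → Fin.<-irrefl refl (proj₂ (toWitness t)))

  rank-injective : ∀ {x y} → P x → P y → rank x ≡ rank y → x ≡ y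
  rank-injective {x} {y} Px Py eq with Fin.<-cmp x y
  ... | tri< x<y _ _ = ⊥-elim (<⇒≢ (rank-mono-< Px x<y) eq)
  ... | tri≈ _ x≡y _ = x≡y
  ... | tri> _ _ y<x = ⊥-elim (<⇒≢ (rank-mono-< Py y<x) (sym eq))

foldr-⊔-lub : ∀ {m xs} → All (_≤ m) xs → foldr _⊔_ 0 xs ≤ m
foldr-⊔-lub [] = z≤n
foldr-⊔-lub (x≤m ∷ xs≤m) = ⊔-lub x≤m (foldr-⊔-lub xs≤m)

≤-foldr-⊔ : ∀ {m xs} → Any (m ≤_) xs → m ≤ foldr _⊔_ 0 xs
≤-foldr-⊔ {xs = x ∷ xs} (here m≤x) = ≤-trans m≤x (m≤m⊔n x _)
≤-foldr-⊔ {xs = x ∷ xs} (there m≤xs) = ≤-trans (≤-foldr-⊔ m≤xs) (m≤n⊔m x _)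

module _ {n : ℕ} (G : Graph n) where
  open Graph G using (adj; irrefl)

  Edge-sym : ∀ {u v} → Edge G u v → Edge G v u
  Edge-sym {u} {v} = subst T (Graph.sym G u v)

  Edge-irrefl : ∀ {u v} → Edge G u v → u ≢ v
  Edge-irrefl {u} e refl = subst T (irrefl u) e

  neighbours : Fin n → List (Fin n)
  neighbours u = filter (λ v → T? (adj u v)) (allFin n)

  neighbours-unique : ∀ u → Unique (neighbours u)
  neighbours-unique u = filter⁺ (λ v → T? (adj u v)) (allFin⁺ n)

  Edge⇒∈-neighbours : ∀ {u v} → Edge G u v → v ∈ neighbours u
  Edge⇒∈-neighbours {u} {v} = ∈-filter⁺ (λ v → T? (adj u v)) (∈-allFin v)

  ∈-neighbours⇒Edge : ∀ {u v} → v ∈ neighbours u → Edge G u v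
  ∈-neighbours⇒Edge {u} v∈ = proj₂ (∈-filter⁻ (λ v → T? (adj u v)) {xs = allFin n} v∈)

  deg≡length-neighbours : ∀ u → deg G u ≡ length (neighbours u)
  deg≡length-neighbours u = sym (length-filter-T? (adj u) (allFin n))

  Edge⇒deg≥1 : ∀ {u v} → Edge G u v → 1 ≤ deg G u
  Edge⇒deg≥1 {u} e = subst (1 ≤_) (sym (deg≡length-neighbours u)) (∈-length (Edge⇒∈-neighbours e))

  deg+deg∸1≤rw : ∀ {u v} → Edge G u v → deg G u + deg G v ∸ 1 ≤ rw G
  deg+deg∸1≤rw {u} {v} e =
    ≤-foldr-⊔ (Any.concat⁺ (Any.map⁺ (Any.tabulate⁺ u (Any.map⁺ (Any.tabulate⁺ v weight≤)))))
    where
    weight≤ : deg G u + deg G v ∸ 1 ≤ (if adj u v then deg G u + deg G v ∸ 1 else 0)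
    weight≤ with adj u v
    ... | true = ≤-refl

  Edge⇒deg≤rw : ∀ {u v} → Edge G u v → deg G u ≤ rw G
  Edge⇒deg≤rw {u} {v} uv = begin
    deg G u                  ≤⟨ m≤m+n (deg G u) (deg G v ∸ 1) ⟩
    deg G u + (deg G v ∸ 1)  ≡⟨ sym (+-∸-assoc (deg G u) (Edge⇒deg≥1 (Edge-sym uv))) ⟩
    deg G u + deg G v ∸ 1    ≤⟨ deg+deg∸1≤rw uv ⟩
    rw G                     ∎
    where open ≤-Reasoning

  rw≤ : ∀ {m} → (∀ u v → Edge G u v → deg G u + deg G v ∸ 1 ≤ m) → rw G ≤ m
  rw≤ {m} bound =
    foldr-⊔-lub (All.concat⁺ (All.map⁺ (All.tabulate⁺ λ u →
      All.map⁺ (All.tabulate⁺ λ v → weight≤ u v))))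
    where
    weight≤ : ∀ u v → (if adj u v then deg G u + deg G v ∸ 1 else 0) ≤ m
    weight≤ u v with adj u v in eq
    ... | true  = bound u v (subst T (sym eq) _)
    ... | false = z≤n

  IsPath₃ : ∀ {a b c} → Edge G a b → Edge G b c → a ≢ c → IsPath G (a ∷ b ∷ c ∷ [])
  IsPath₃ ab bc a≢c = (Edge-irrefl ab ∷ a≢c ∷ []) ∷ (Edge-irrefl bc ∷ []) ∷ [] ∷ [] , ab ∷ bc ∷ [-]

  IsPath₄ : ∀ {a b c d} → Edge G a b → Edge G b c → Edge G c d → a ≢ c → b ≢ d → a ≢ d →
            IsPath G (a ∷ b ∷ c ∷ d ∷ [])
  IsPath₄ ab bc cd a≢c b≢d a≢d =
    (Edge-irrefl ab ∷ a≢c ∷ a≢d ∷ []) ∷ (Edge-irrefl bc ∷ b≢d ∷ []) ∷ (Edge-irrefl cd ∷ []) ∷ [] ∷ [] ,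
    ab ∷ bc ∷ cd ∷ [-]

  record ShortPathsRainbow {k} (φ : EdgeColouring G k) : Set where
    open EdgeColouring φ
    field
      two-edges   : ∀ {a b c} → Edge G a b → Edge G b c → a ≢ c → col a b ≢ col b c
      three-edges : ∀ {a b c d} → Edge G a b → Edge G b c → Edge G c d → a ≢ c → b ≢ d → a ≢ d →
                    col a b ≢ col c d

  module _ {k} {φ : EdgeColouring G k} (rainbow : ShortPathsRainbow φ) where
    open EdgeColouring φ
    open ShortPathsRainbow rainbow

    col-≢-at-vertex : ∀ {w x y} → Edge G w x → Edge G w y → x ≢ y → col w x ≢ col w y
    col-≢-at-vertex {w} {x} wx wy x≢y wx≡wy =
      two-edges (Edge-sym wx) wy x≢y (trans (col-sym x w (Edge-sym wx)) wx≡wy)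

    col-≢-at-edge : ∀ {u v x y} → Edge G u v → Edge G u x → Edge G v y → y ≢ u → col u x ≢ col v y
    col-≢-at-edge {u} {v} {x} {y} uv ux vy y≢u with x ≟ v | x ≟ y
    ... | yes refl | _        = two-edges uv vy (≢-sym y≢u)
    ... | no _     | yes refl = λ ux≡vx → two-edges ux (Edge-sym vy) (Edge-irrefl uv)
                                            (trans ux≡vx (col-sym v x vy))
    ... | no x≢v   | no x≢y   = λ ux≡vy → three-edges (Edge-sym ux) uv vy x≢v (≢-sym y≢u) x≢y
                                            (trans (sym (col-sym u x ux)) ux≡vy)

    shortPathsRainbow⇒deg+deg∸1≤k : ∀ {u v} → Edge G u v → deg G u + deg G v ∸ 1 ≤ k
    shortPathsRainbow⇒deg+deg∸1≤k {u} {v} uv = begin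
      deg G u + deg G v ∸ 1           ≡⟨ +-∸-assoc (deg G u) (Edge⇒deg≥1 (Edge-sym uv)) ⟩
      deg G u + (deg G v ∸ 1)         ≤⟨ +-monoʳ-≤ (deg G u) deg∸1≤ ⟩
      deg G u + length farNeighbours  ≡⟨ sym length-colours ⟩
      length colours                  ≤⟨ Unique⇒length≤ colours-unique ⟩
      k                               ∎
      where
      open ≤-Reasoning
      farNeighbours : List (Fin n)
      farNeighbours = filter (λ y → ¬? (y ≟ u)) (neighbours v)

      ∈-farNeighbours : ∀ {y} → y ∈ farNeighbours → Edge G v y × y ≢ u
      ∈-farNeighbours y∈ with y∈N , y≢u ← ∈-filter⁻ (λ y → ¬? (y ≟ u)) {xs = neighbours v} y∈ =
        ∈-neighbours⇒Edge y∈N , y≢u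

      deg∸1≤ : deg G v ∸ 1 ≤ length farNeighbours
      deg∸1≤ = m≤n+o⇒m∸n≤o (deg G v) 1
        (subst (_≤ suc (length farNeighbours)) (sym (deg≡length-neighbours v))
               (length≤1+length-filter-≢ _≟_ u (neighbours-unique v)))

      colours : List (Fin k)
      colours = map (col u) (neighbours u) ++ map (col v) farNeighbours

      length-colours : length colours ≡ deg G u + length farNeighbours
      length-colours = trans (length-++ (map (col u) (neighbours u)))
        (cong₂ _+_ (trans (length-map (col u) (neighbours u)) (sym (deg≡length-neighbours u)))
                   (length-map (col v) farNeighbours))

      colours-unique : Unique colours
      colours-unique = Unique.++⁺
        (Unique-map⁺-∈ (λ x∈ y∈ → col-≢-at-vertex (∈-neighbours⇒Edge x∈) (∈-neighbours⇒Edge y∈))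
          (neighbours-unique u))
        (Unique-map⁺-∈
          (λ x∈ y∈ → col-≢-at-vertex (proj₁ (∈-farNeighbours x∈)) (proj₁ (∈-farNeighbours y∈)))
          (Unique.filter⁺ _ (neighbours-unique v)))
        λ (c∈ , c∈′) → disjoint (∈-map⁻ (col u) c∈) (∈-map⁻ (col v) c∈′)
        where
        disjoint : ∀ {c} → (∃ λ x → x ∈ neighbours u × c ≡ col u x) →
                   (∃ λ y → y ∈ farNeighbours × c ≡ col v y) → ⊥
        disjoint (x , x∈ , refl) (y , y∈ , ux≡vy) with vy , y≢u ← ∈-farNeighbours y∈ =
          col-≢-at-edge uv (∈-neighbours⇒Edge x∈) vy y≢u ux≡vy

    shortPathsRainbow⇒loose : ∀ {u v} vs → PathBetween G u v vs → u ≢ v → IsLoosePath G φ vs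
    shortPathsRainbow⇒loose (a ∷ []) (_ , refl , refl) u≢v = ⊥-elim (u≢v refl)
    shortPathsRainbow⇒loose (a ∷ b ∷ []) _ _ = inj₁ refl
    shortPathsRainbow⇒loose (a ∷ b ∷ c ∷ []) (((_ ∷ a≢c ∷ []) ∷ _ , ab ∷ bc ∷ _) , _) _ =
      inj₂ (inj₁ (_ , _ , refl , two-edges ab bc a≢c))
    shortPathsRainbow⇒loose (a ∷ b ∷ c ∷ d ∷ _)
      (((_ ∷ a≢c ∷ a≢d ∷ _) ∷ (_ ∷ b≢d ∷ _) ∷ _ , ab ∷ bc ∷ cd ∷ _) , _) _ =
      inj₂ (inj₂ (s≤s (s≤s (s≤s z≤n)) , _ , _ , _ , here refl , there (here refl) , there (there (here refl)) ,
                  two-edges ab bc a≢c , three-edges ab bc cd a≢c b≢d a≢d , two-edges bc cd b≢d))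

    connected⇒looseConnecting : Connected G → IsLooseConnecting G φ
    connected⇒looseConnecting connected u v u≢v with vs , between ← connected u v =
      vs , between , shortPathsRainbow⇒loose vs between u≢v

module Forest {n : ℕ} (G : Graph n) (acyclic : ¬ HasCycle G) where
  open import Data.List.Membership.DecPropositional (_≟_ {n}) using (_∈?_)

  chord⇒adjacent : ∀ {a b} xs {ys} → IsPath G (a ∷ xs ++ b ∷ ys) → Edge G a b → xs ≡ []
  chord⇒adjacent [] _ _ = refl
  chord⇒adjacent {a} {b} (x ∷ xs) (u , l) ab = ⊥-elim (acyclic (a ∷ x ∷ xs ++ b ∷ [] ,
    (Unique-truncate (a ∷ x ∷ xs) u , Linked-truncate (a ∷ x ∷ xs) l) ,
    s≤s (s≤s (subst (1 ≤_) (sym (length-++ xs)) (m≤n+m 1 (length xs)))) ,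
    a , b , refl , last-snoc a (x ∷ xs) b , Edge-sym G ab))

  path-unique : ∀ a P Q → IsPath G (a ∷ P) → IsPath G (a ∷ Q) → last (a ∷ P) ≡ last (a ∷ Q) → P ≡ Q
  path-unique a [] [] _ _ _ = refl
  path-unique a [] (d ∷ Q) _ (a∉ ∷ _ , _) eq = ⊥-elim (All¬⇒¬Any a∉ (last-∈ d Q (sym eq)))
  path-unique a (c ∷ P) [] (a∉ ∷ _ , _) _ eq = ⊥-elim (All¬⇒¬Any a∉ (last-∈ c P eq))
  path-unique a (c ∷ P) (d ∷ Q) (a∉ ∷ uP , ac ∷ lP) (a∉′ ∷ uQ , ad ∷ lQ) eq with c ≟ d
  ... | yes refl = cong (c ∷_) (path-unique c P Q (uP , lP) (uQ , lQ) eq)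
  ... | no c≢d with c ∈? Q
  ...   | yes c∈Q with as , bs , refl ← ∈-∃++ c∈Q
                  with () ← chord⇒adjacent (d ∷ as) (a∉′ ∷ uQ , ad ∷ lQ) ac
  ...   | no c∉Q = ⊥-elim (All¬⇒¬Any a∉ (there (subst (a ∈_) (sym P≡adQ) (here refl))))
    where
    c∉adQ : All (c ≢_) (a ∷ d ∷ Q)
    c∉adQ = ≢-sym (Edge-irrefl G ac) ∷ c≢d ∷ ¬Any⇒All¬ Q c∉Q
    P≡adQ : P ≡ a ∷ d ∷ Q
    P≡adQ = path-unique c P (a ∷ d ∷ Q) (uP , lP) (c∉adQ ∷ a∉′ ∷ uQ , Edge-sym G ac ∷ ad ∷ lQ) eq

  PathBetween⇒≡ : ∀ {x y vs} Q → PathBetween G x y vs → IsPath G (x ∷ Q) → last (x ∷ Q) ≡ just y →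
                  vs ≡ x ∷ Q
  PathBetween⇒≡ {vs = x ∷ P} Q (p , refl , lastP) q lastQ =
    cong (x ∷_) (path-unique x P Q p q (trans lastP (sym lastQ)))

  looseConnecting⇒shortPathsRainbow : ∀ {k} {φ : EdgeColouring G k} →
                                      IsLooseConnecting G φ → ShortPathsRainbow G φ
  looseConnecting⇒shortPathsRainbow {φ = φ} loose = record { two-edges = two-edges ; three-edges = three-edges }
    where
    open EdgeColouring φ
    two-edges : ∀ {a b c} → Edge G a b → Edge G b c → a ≢ c → col a b ≢ col b c
    two-edges {a} {b} {c} ab bc a≢c with loose a c a≢c
    ... | vs , between , isLoose with refl ← PathBetween⇒≡ (b ∷ c ∷ []) between (IsPath₃ G ab bc a≢c) refl
                                 with isLoose
    ... | inj₁ ()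
    ... | inj₂ (inj₁ (_ , _ , refl , x≢y)) = x≢y
    ... | inj₂ (inj₂ (s≤s (s≤s ()) , _))
    three-edges : ∀ {a b c d} → Edge G a b → Edge G b c → Edge G c d → a ≢ c → b ≢ d → a ≢ d →
                  col a b ≢ col c d
    three-edges {a} {b} {c} {d} ab bc cd a≢c b≢d a≢d ab≡cd with loose a d a≢d
    ... | vs , between , isLoose
            with refl ← PathBetween⇒≡ (b ∷ c ∷ d ∷ []) between (IsPath₄ G ab bc cd a≢c b≢d a≢d) refl
            with isLoose
    ... | inj₁ ()
    ... | inj₂ (inj₁ (_ , _ , () , _))
    ... | inj₂ (inj₂ (_ , _ , _ , _ , x∈ , y∈ , z∈ , x≢y , x≢z , y≢z)) =
          no-three-distinct-in-pair (⊆-pair x∈) (⊆-pair y∈) (⊆-pair z∈) x≢y x≢z y≢z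
      where
      ⊆-pair : ∀ {x} → x ∈ col a b ∷ col b c ∷ col c d ∷ [] → x ∈ col a b ∷ col b c ∷ []
      ⊆-pair (here x≡) = here x≡
      ⊆-pair (there (here x≡)) = there (here x≡)
      ⊆-pair (there (there (here x≡))) = here (trans x≡ (sym ab≡cd))

module Rooted {n : ℕ} (G : Graph n) (tree : IsTree G) (root : Fin n) where
  open Forest G (proj₂ tree)
  open import Data.List.Membership.DecPropositional (_≟_ {n}) using (_∈?_)

  pathToRoot : ∀ v → Σ (List (Fin n)) λ P → IsPath G (v ∷ P) × last (v ∷ P) ≡ just root
  pathToRoot v with (v ∷ P) , p , refl , l ← proj₁ tree v root = P , p , l

  ancestors : Fin n → List (Fin n)
  ancestors v = proj₁ (pathToRoot v)

  ancestors-path : ∀ v → IsPath G (v ∷ ancestors v)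
  ancestors-path v = proj₁ (proj₂ (pathToRoot v))

  ancestors-last : ∀ v → last (v ∷ ancestors v) ≡ just root
  ancestors-last v = proj₂ (proj₂ (pathToRoot v))

  ancestors-unique : ∀ {v} P → IsPath G (v ∷ P) → last (v ∷ P) ≡ just root → ancestors v ≡ P
  ancestors-unique {v} P p l =
    path-unique v (ancestors v) P (ancestors-path v) p (trans (ancestors-last v) (sym l))

  ancestors-root : ancestors root ≡ []
  ancestors-root = ancestors-unique [] ([] ∷ [] , [-]) refl

  ancestors≡∷⇒≢root : ∀ {v p P} → ancestors v ≡ p ∷ P → v ≢ root
  ancestors≡∷⇒≢root eq refl with () ← trans (sym ancestors-root) eq

  -- The root is its own parent; this junk value is never used.
  parent : Fin n → Fin n
  parent v = fromMaybe v (head (ancestors v))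

  parent-≡ : ∀ {v p P} → ancestors v ≡ p ∷ P → parent v ≡ p
  parent-≡ {v} = cong (fromMaybe v ∘ head)

  depth : Fin n → ℕ
  depth v = length (ancestors v)

  ancestors-∷ : ∀ {v} → v ≢ root → ∃ λ p → ancestors v ≡ p ∷ ancestors p
  ancestors-∷ {v} v≢r with ancestors v | ancestors-path v | ancestors-last v
  ... | []    | _             | l     = ⊥-elim (v≢r (just-injective l))
  ... | p ∷ P | (_ ∷ u , _ ∷ l) | last≡ = p , cong (p ∷_) (sym (ancestors-unique P (u , l) last≡))

  ancestors-step : ∀ {v} → v ≢ root → ancestors v ≡ parent v ∷ ancestors (parent v)
  ancestors-step {v} v≢r with p , eq ← ancestors-∷ v≢r =
    trans eq (cong (λ q → q ∷ ancestors q) (sym (parent-≡ eq)))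

  depth-step : ∀ {v} → v ≢ root → depth v ≡ suc (depth (parent v))
  depth-step v≢r = cong length (ancestors-step v≢r)

  depth-root : depth root ≡ 0
  depth-root = cong length ancestors-root

  Edge-parent : ∀ {v} → v ≢ root → Edge G v (parent v)
  Edge-parent {v} v≢r
    with _ , (e ∷ _) ← subst (IsPath G ∘ (v ∷_)) (ancestors-step v≢r) (ancestors-path v) = e

  ChildOf : Fin n → Fin n → Set
  ChildOf w p = w ≢ root × parent w ≡ p

  childOf? : ∀ w p → Dec (ChildOf w p)
  childOf? w p = ¬? (w ≟ root) ×-dec (parent w ≟ p)

  ChildOf⇒Edge : ∀ {w p} → ChildOf w p → Edge G p w
  ChildOf⇒Edge (w≢r , refl) = Edge-sym G (Edge-parent w≢r)

  ChildOf⇒depth> : ∀ {w p} → ChildOf w p → depth p < depth w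
  ChildOf⇒depth> {w} (w≢r , refl) = subst (depth (parent w) <_) (sym (depth-step w≢r)) ≤-refl

  ChildOf-asym : ∀ {a b} → ChildOf a b → ¬ ChildOf b a
  ChildOf-asym ab ba = <-asym (ChildOf⇒depth> ba) (ChildOf⇒depth> ab)

  Edge⇒ChildOf : ∀ {a b} → Edge G a b → ChildOf a b ⊎ ChildOf b a
  Edge⇒ChildOf {a} {b} ab with b ∈? ancestors a
  ... | yes b∈ with as , bs , eq ← ∈-∃++ b∈
               with refl ← chord⇒adjacent as (subst (IsPath G ∘ (a ∷_)) eq (ancestors-path a)) ab =
    inj₁ (ancestors≡∷⇒≢root eq , parent-≡ eq)
  ... | no b∉ = inj₂ (ancestors≡∷⇒≢root eq , parent-≡ eq)
    where
    b∉a∷ : All (b ≢_) (a ∷ ancestors a)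
    b∉a∷ = ≢-sym (Edge-irrefl G ab) ∷ ¬Any⇒All¬ _ b∉
    eq : ancestors b ≡ a ∷ ancestors a
    eq = ancestors-unique (a ∷ ancestors a)
           (b∉a∷ ∷ proj₁ (ancestors-path a) , Edge-sym G ab ∷ proj₂ (ancestors-path a)) (ancestors-last a)

  childCount : Fin n → ℕ
  childCount p = size (λ w → childOf? w p)

  siblingRank : Fin n → ℕ
  siblingRank v = rank (λ w → childOf? w (parent v)) v

  childCount≤deg : ∀ p → childCount p ≤ deg G p
  childCount≤deg p = countᵇ-mono (allFin n) (λ _ t → ChildOf⇒Edge (toWitness t))

  childCount<deg : ∀ {p} → p ≢ root → childCount p < deg G p
  childCount<deg {p} p≢r =
    countᵇ-mono-< (allFin n) (λ _ t → ChildOf⇒Edge (toWitness t)) (∈-allFin (parent p)) (Edge-parent p≢r)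
      (λ t → ChildOf-asym (p≢r , refl) (toWitness t))

  siblingRank<childCount : ∀ {v p} → ChildOf v p → siblingRank v < childCount p
  siblingRank<childCount (v≢r , refl) = rank<size (λ w → childOf? w _) (v≢r , refl)

  siblingRank-injective : ∀ {v w p} → ChildOf v p → ChildOf w p → siblingRank v ≡ siblingRank w → v ≡ w
  siblingRank-injective {w = w} (v≢r , refl) (w≢r , pw≡pv) eq =
    rank-injective (λ x → childOf? x _) (v≢r , refl) (w≢r , pw≡pv)
      (trans eq (cong (λ p → rank (λ x → childOf? x p) w) pw≡pv))

-- c₀ is only the out-of-range default of nth; no index used below is out of range.
module TreeColouring {n : ℕ} (G : Graph n) (tree : IsTree G) (root : Fin n)
                     (deg-root≤rw : deg G root ≤ rw G) (c₀ : Fin (rw G)) where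
  open Rooted G tree root

  Colour : Set
  Colour = Fin (rw G)

  -- palette p holds the colours not used at parent p, and the edges from g down to its children
  -- take the first childCount g colours of palette g. Since the colours at g involve the palette
  -- of parent g, both are defined by recursion on the depth.
  mutual
    palette′ : ℕ → Fin n → List Colour
    palette′ zero    p = allFin (rw G)
    palette′ (suc m) p = free (coloursAt′ m (parent p))

    coloursAt′ : ℕ → Fin n → List Colour
    coloursAt′ zero    g = take (childCount g) (palette′ zero g)
    coloursAt′ (suc m) g =
      nth c₀ (palette′ m (parent g)) (siblingRank g) ∷ take (childCount g) (palette′ (suc m) g)

  palette : Fin n → List Colour
  palette p = palette′ (depth p) p

  coloursAt : Fin n → List Colour
  coloursAt g = coloursAt′ (depth g) g

  colour : Fin n → Colour
  colour v = nth c₀ (palette (parent v)) (siblingRank v)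

  palette-root : palette root ≡ allFin (rw G)
  palette-root = cong (λ m → palette′ m root) depth-root

  palette-step : ∀ {p} → p ≢ root → palette p ≡ free (coloursAt (parent p))
  palette-step {p} p≢r = cong (λ m → palette′ m p) (depth-step p≢r)

  coloursAt-root : coloursAt root ≡ take (childCount root) (palette root)
  coloursAt-root = trans (cong (λ m → coloursAt′ m root) depth-root)
                         (cong (λ m → take (childCount root) (palette′ m root)) (sym depth-root))

  coloursAt-step : ∀ {g} → g ≢ root → coloursAt g ≡ colour g ∷ take (childCount g) (palette g)
  coloursAt-step {g} g≢r = trans (cong (λ m → coloursAt′ m g) (depth-step g≢r))
    (cong (λ m → colour g ∷ take (childCount g) (palette′ m g)) (sym (depth-step g≢r)))

  palette-unique : ∀ p → Unique (palette p)
  palette-unique p with p ≟ root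
  ... | yes refl = subst Unique (sym palette-root) (allFin⁺ (rw G))
  ... | no p≢r   = subst Unique (sym (palette-step p≢r)) (free-unique _)

  take-palette⊆coloursAt : ∀ g {c} → c ∈ take (childCount g) (palette g) → c ∈ coloursAt g
  take-palette⊆coloursAt g c∈ with g ≟ root
  ... | yes refl = subst (_ ∈_) (sym coloursAt-root) c∈
  ... | no g≢r   = subst (_ ∈_) (sym (coloursAt-step g≢r)) (there c∈)

  length-coloursAt : ∀ g → length (coloursAt g) ≤ deg G g
  length-coloursAt g with g ≟ root
  ... | yes refl = subst (λ cs → length cs ≤ deg G root) (sym coloursAt-root)
                     (≤-trans (length-take≤ (childCount root) (palette root)) (childCount≤deg root))
  ... | no g≢r   = subst (λ cs → length cs ≤ deg G g) (sym (coloursAt-step g≢r))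
                     (≤-trans (s≤s (length-take≤ (childCount g) (palette g))) (childCount<deg g≢r))

  childCount≤length-palette : ∀ p → childCount p ≤ length (palette p)
  childCount≤length-palette p with p ≟ root
  ... | yes refl = subst (λ cs → childCount root ≤ length cs) (sym palette-root)
        (≤-trans (childCount≤deg root) (≤-trans deg-root≤rw (≤-reflexive (sym (length-tabulate id)))))
  ... | no p≢r = begin
    childCount p                          ≤⟨ m+n≤o⇒m≤o∸n (childCount p) childCount+deg-parent≤rw ⟩
    rw G ∸ deg G (parent p)               ≤⟨ ∸-monoʳ-≤ (rw G) (length-coloursAt (parent p)) ⟩
    rw G ∸ length (coloursAt (parent p))  ≤⟨ length-free (coloursAt (parent p)) ⟩
    length (free (coloursAt (parent p)))  ≡⟨ cong length (sym (palette-step p≢r)) ⟩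
    length (palette p)                    ∎
    where
    open ≤-Reasoning
    childCount+deg-parent≤rw : childCount p + deg G (parent p) ≤ rw G
    childCount+deg-parent≤rw = ≤-trans (∸-monoˡ-≤ 1 (+-monoˡ-≤ (deg G (parent p)) (childCount<deg p≢r)))
                                        (deg+deg∸1≤rw G (Edge-parent p≢r))

  siblingRank<length-palette : ∀ {v p} → ChildOf v p → siblingRank v < length (palette p)
  siblingRank<length-palette v↑p = <-≤-trans (siblingRank<childCount v↑p) (childCount≤length-palette _)

  colour∈coloursAt-parent : ∀ {v} → v ≢ root → colour v ∈ coloursAt (parent v)
  colour∈coloursAt-parent v≢r = take-palette⊆coloursAt _
    (nth∈take c₀ _ (siblingRank<childCount (v≢r , refl)) (siblingRank<length-palette (v≢r , refl)))

  colour∈coloursAt : ∀ {g} → g ≢ root → colour g ∈ coloursAt g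
  colour∈coloursAt {g} g≢r = subst (colour g ∈_) (sym (coloursAt-step g≢r)) (here refl)

  colour∉coloursAt-grandparent : ∀ {v} → v ≢ root → parent v ≢ root →
                                 colour v ∉ coloursAt (parent (parent v))
  colour∉coloursAt-grandparent {v} v≢r pv≢r = ∈-free⇒∉ _
    (subst (colour v ∈_) (palette-step pv≢r) (∈-nth c₀ _ (siblingRank<length-palette (v≢r , refl))))

  colour-injective-on-siblings : ∀ {v w p} → ChildOf v p → ChildOf w p → colour v ≡ colour w → v ≡ w
  colour-injective-on-siblings {w = w} {p} v↑p@(_ , refl) w↑p@(_ , pw≡p) eq =
    siblingRank-injective v↑p w↑p
      (nth-injective c₀ (palette-unique p) (siblingRank<length-palette v↑p) (siblingRank<length-palette w↑p)
        (trans eq (cong (λ q → nth c₀ (palette q) (siblingRank w)) pw≡p)))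

  col : Fin n → Fin n → Colour
  col a b = if isYes (childOf? a b) then colour a else colour b

  col-child : ∀ {a b} → ChildOf a b → col a b ≡ colour a × col b a ≡ colour a
  col-child {a} {b} a↑b with childOf? a b | childOf? b a
  ... | no ¬a↑b | _       = ⊥-elim (¬a↑b a↑b)
  ... | yes _   | yes b↑a = ⊥-elim (ChildOf-asym a↑b b↑a)
  ... | yes _   | no _    = refl , refl

  col-sym : ∀ {a b} → Edge G a b → col a b ≡ col b a
  col-sym ab with Edge⇒ChildOf ab
  ... | inj₁ a↑b = let (ab≡ , ba≡) = col-child a↑b in trans ab≡ (sym ba≡)
  ... | inj₂ b↑a = let (ba≡ , ab≡) = col-child b↑a in trans ab≡ (sym ba≡)

  colouring : EdgeColouring G (rw G)
  colouring = record { col = col ; col-sym = λ _ _ → col-sym }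

  col∈coloursAt : ∀ {g w} → Edge G g w → col g w ∈ coloursAt g
  col∈coloursAt {g} gw with Edge⇒ChildOf gw
  ... | inj₁ g↑w@(g≢r , _) = subst (_∈ coloursAt g) (sym (proj₁ (col-child g↑w))) (colour∈coloursAt g≢r)
  ... | inj₂ w↑g@(w≢r , pw≡g) =
    subst₂ _∈_ (sym (proj₂ (col-child w↑g))) (cong coloursAt pw≡g) (colour∈coloursAt-parent w≢r)

  col-grandchild : ∀ {a b c d} → ChildOf a b → ChildOf b c → Edge G c d → col a b ≢ col c d
  col-grandchild {a} a↑b@(a≢r , refl) (pa≢r , refl) cd ab≡cd =
    colour∉coloursAt-grandparent a≢r pa≢r
      (subst (_∈ coloursAt (parent (parent a))) (trans (sym ab≡cd) (proj₁ (col-child a↑b)))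
             (col∈coloursAt cd))

  colouring-shortPathsRainbow : ShortPathsRainbow G colouring
  colouring-shortPathsRainbow = record { two-edges = two-edges ; three-edges = three-edges }
    where
    two-edges : ∀ {a b c} → Edge G a b → Edge G b c → a ≢ c → col a b ≢ col b c
    two-edges ab bc a≢c with Edge⇒ChildOf ab | Edge⇒ChildOf bc
    ... | inj₁ a↑b | inj₁ b↑c = λ eq → col-grandchild a↑b b↑c (Edge-sym G bc) (trans eq (col-sym bc))
    ... | inj₁ a↑b | inj₂ c↑b = λ eq → a≢c (colour-injective-on-siblings a↑b c↑b
                                  (trans (sym (proj₁ (col-child a↑b))) (trans eq (proj₂ (col-child c↑b)))))
    ... | inj₂ (_ , pb≡a) | inj₁ (_ , pb≡c) = ⊥-elim (a≢c (trans (sym pb≡a) pb≡c))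
    ... | inj₂ b↑a | inj₂ c↑b = λ eq → col-grandchild c↑b b↑a ab (trans (sym (col-sym bc)) (sym eq))

    three-edges : ∀ {a b c d} → Edge G a b → Edge G b c → Edge G c d → a ≢ c → b ≢ d → a ≢ d →
                  col a b ≢ col c d
    three-edges ab bc cd a≢c b≢d _ with Edge⇒ChildOf bc
    three-edges ab bc cd a≢c b≢d _ | inj₁ b↑c with Edge⇒ChildOf ab
    ... | inj₁ a↑b        = col-grandchild a↑b b↑c cd
    ... | inj₂ (_ , pb≡a) = ⊥-elim (a≢c (trans (sym pb≡a) (proj₂ b↑c)))
    three-edges ab bc cd a≢c b≢d _ | inj₂ c↑b with Edge⇒ChildOf cd
    ... | inj₂ d↑c        = λ eq → col-grandchild d↑c c↑b (Edge-sym G ab)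
                                     (trans (sym (col-sym cd)) (trans (sym eq) (col-sym ab)))
    ... | inj₁ (_ , pc≡d) = ⊥-elim (b≢d (trans (sym (proj₂ c↑b)) pc≡d))

lemma1 : (n : ℕ) (G : Graph n) → IsTree G → HasEdge G → LecIs G (rw G)
lemma1 n G tree (u , v , uv) = upper , lower
  where
  open Forest G (proj₂ tree)
  open TreeColouring G tree u (Edge⇒deg≤rw G uv)
                     (fromℕ< (<-≤-trans (Edge⇒deg≥1 G uv) (Edge⇒deg≤rw G uv)))

  upper : LooseColourable G (rw G)
  upper = colouring , connected⇒looseConnecting G colouring-shortPathsRainbow (proj₁ tree)

  lower : ∀ k → LooseColourable G k → rw G ≤ k
  lower k (φ , loose) = rw≤ G λ a b →
    shortPathsRainbow⇒deg+deg∸1≤k G (looseConnecting⇒shortPathsRainbow {φ = φ} loose) {a} {b}
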